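{- Let $G=(V\cup\{O\},E)$ be a connected, unweighted, undirected graph, where $V$ is a set of $n$ terminals and $O\notin V$ is the depot, and let $k\in[1,n]$ be an integer tour capacity. Let $\mathrm{opt}$ be the cost of an optimal solution to the graphic CVRP on this instance, and let $\mathrm{rad}=\frac{2}{k}\sum_{v\in V}\mathrm{dist}(v)$. Then \[ \mathrm{opt}\geq \mathrm{rad}+\frac{n}{2}-\frac{n}{2k^2}. \]
   Context: For $v\in V$, $\mathrm{dist}(v)$ is the number of edges on a shortest $v$-to-$O$ path in $G$. A tour is a walk $z_1z_2\dots z_p$ in $G$ ($p\ge 1$) with $z_1=z_p=O$ and $(z_i,z_{i+1})\in E$ for all $i\in[1,p-1]$; its cost is $p-1$, the number of edges traversed (with multiplicity). The graphic capacitated vehicle routing problem (graphic CVRP) asks for a collection of tours together with an assignment of each terminal to exactly one tour that visits it (the tour "covers" that terminal's unit demand), such that each tour covers at most $k$ terminals; the objective is to minimize the total cost of the tours. $\mathrm{opt}$ denotes the minimum total cost. -}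

module Defs where

open import Data.Nat using (ℕ; zero; suc; _+_; _*_; _≤_)
open import Data.Fin using (Fin; _≟_)
open import Data.List using (List; length; filter; map)
open import Data.Nat.ListAction using (sum)
open import Data.List.Base using (allFin)
open import Data.Product using (Σ; ∃; _×_; _,_; proj₁; proj₂)
open import Relation.Binary.PropositionalEquality using (_≡_)
open import Relation.Nullary using (¬_)

Vertex : ℕ → Set
Vertex n = Fin (suc n)

depot : ∀ {n} → Vertex n
depot = Fin.zero

terminal : ∀ {n} → Fin n → Vertex n
terminal i = Fin.suc i

record Graph (n : ℕ) : Set₁ where
  field
    Adj   : Vertex n → Vertex n → Set
    sym   : ∀ {u v} → Adj u v → Adj v u
    irrefl : ∀ {u} → ¬ Adj u u

data Walk {n} (G : Graph n) : Vertex n → Vertex n → ℕ → Set where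
  here : ∀ {u} → Walk G u u 0
  step : ∀ {u w v m} → Graph.Adj G u w → Walk G w v m → Walk G u v (suc m)

data Visits {n} {G : Graph n} (x : Vertex n) : ∀ {u v m} → Walk G u v m → Set where
  vis-here  : Visits x (here {u = x})
  vis-start : ∀ {w v m} (e : Graph.Adj G x w) (p : Walk G w v m) → Visits x (step e p)
  vis-later : ∀ {u w v m} (e : Graph.Adj G u w) (p : Walk G w v m) → Visits x p → Visits x (step e p)

Connected : ∀ {n} → Graph n → Set
Connected {n} G = (u v : Vertex n) → ∃ λ m → Walk G u v m

IsDist : ∀ {n} → Graph n → Vertex n → ℕ → Set
IsDist G u d = Walk G u depot d × (∀ {m} → Walk G u depot m → d ≤ m)

Tour : ∀ {n} → Graph n → Set
Tour G = Σ ℕ λ m → Walk G depot depot m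

cost : ∀ {n} {G : Graph n} → Tour G → ℕ
cost = proj₁

load : ∀ {n t} → (Fin n → Fin t) → Fin t → ℕ
load {n} a j = length (filter (λ i → a i ≟ j) (allFin n))

record Solution {n} (G : Graph n) (k : ℕ) : Set where
  field
    t        : ℕ
    tours    : Fin t → Tour G
    assign   : Fin n → Fin t
    covers   : ∀ i → Visits (terminal i) (proj₂ (tours (assign i)))
    capacity : ∀ j → load assign j ≤ k
  totalCost : ℕ
  totalCost = sum (map (λ j → cost (tours j)) (allFin t))

module Submission where

-- In a tour of cost c covering a terminals, a terminal at distance d visited at step p has
-- d ≤ p ≤ c − d, and distinct terminals occupy distinct steps. With d₁ ≤ d₂ ≤ … ≤ dₐ, the
-- a − i + 1 terminals from the i-th on therefore fit into the c − 2dᵢ + 1 steps of [dᵢ, c − dᵢ].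
-- Adding these window bounds two at a time and halving (which rounds down) gives
-- 4 Σ dᵢ + a² ≤ 2ac + 1, and a ≤ k rescales this to 4k Σ dᵢ + ak² ≤ 2k²c + a. Summing over
-- the tours, whose loads add up to n, gives the theorem.

open import Defs
open import Data.Nat as ℕ using (ℕ; zero; suc; _+_; _*_; _≤_; _<_; z≤n; s≤s)
open import Data.Nat.Properties hiding (_≟_)
open import Data.Nat.ListAction using (sum)
open import Data.Nat.ListAction.Properties using (sum-↭)
open import Data.Nat.Tactic.RingSolver using (solve-∀)
open import Data.Fin as Fin using (Fin; _≟_)
import Data.Fin.Properties as Fin
open import Data.Bool using (if_then_else_; true; false)
open import Data.Product using (∃₂; ∃-syntax; _×_; _,_; proj₁; proj₂)
open import Data.List using (List; []; _∷_; length; map; filter)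
open import Data.List.Base using (allFin)
open import Data.List.Properties using (length-map; map-tabulate; map-cong; length-tabulate)
open import Data.List.Relation.Unary.All as All using (All; []; _∷_)
open import Data.List.Relation.Unary.All.Properties using (¬Any⇒All¬; all-filter)
  renaming (map⁺ to All-map⁺)
open import Data.List.Relation.Unary.AllPairs as AllPairs using ([]; _∷_)
open import Data.List.Relation.Unary.Unique.Propositional using (Unique)
import Data.List.Relation.Unary.Unique.Propositional.Properties as Unique
open import Data.List.Relation.Binary.Permutation.Propositional
  using (_↭_; ↭-refl; ↭-prep; ↭-swap; ↭-trans; ↭⇒↭ₛ)
open import Data.List.Relation.Binary.Permutation.Propositional.Properties
  using (All-resp-↭; shift; ↭-length)
  renaming (map⁺ to ↭-map⁺)
import Data.List.Relation.Binary.Permutation.Setoid.Properties as ↭ₛ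
open import Data.List.Membership.Propositional.Properties using (∈-∃++)
open import Data.List.Membership.DecPropositional ℕ._≟_ using (_∈?_)
open import Relation.Nullary using (yes; no; does; contradiction)
open import Relation.Binary.PropositionalEquality
open import Function using (_∘_)

m+m<n+n⇒m<n : ∀ {m n} → m + m < n + n → m < n
m+m<n+n⇒m<n {m} {n} = *-cancelˡ-< 2 m n ∘ subst₂ _<_ (twice m) (twice n)
  where
  twice : ∀ x → x + x ≡ 2 * x
  twice x = cong (x +_) (sym (+-identityʳ x))

pair-step : ∀ {a c d₁ d₂ S} →
  2 + a + (d₁ + d₁) ≤ suc c → 1 + a + (d₂ + d₂) ≤ suc c →
  4 * S + a * a ≤ 2 * a * c + 1 →
  4 * (d₁ + (d₂ + S)) + (2 + a) * (2 + a) ≤ 2 * (2 + a) * c + 1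
pair-step {a} {c} {d₁} {d₂} {S} window₁ window₂ ih = begin
  4 * (d₁ + (d₂ + S)) + (2 + a) * (2 + a) ≡⟨ expand-lhs a d₁ d₂ S ⟩
  (4 * S + a * a) + 4 * suc (d₁ + d₂ + a)   ≤⟨ +-mono-≤ ih (*-monoʳ-≤ 4 d₁+d₂+a<c) ⟩
  (2 * a * c + 1) + 4 * c                   ≡⟨ expand-rhs a c ⟩
  2 * (2 + a) * c + 1                       ∎
  where
  open ≤-Reasoning
  expand-lhs : ∀ a d₁ d₂ S →
    4 * (d₁ + (d₂ + S)) + (2 + a) * (2 + a) ≡ (4 * S + a * a) + 4 * suc (d₁ + d₂ + a)
  expand-lhs = solve-∀
  expand-rhs : ∀ a c → (2 * a * c + 1) + 4 * c ≡ 2 * (2 + a) * c + 1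
  expand-rhs = solve-∀
  add-windows : ∀ a d₁ d₂ →
    3 + ((d₁ + d₂ + a) + (d₁ + d₂ + a)) ≡ (2 + a + (d₁ + d₁)) + (1 + a + (d₂ + d₂))
  add-windows = solve-∀
  -- the rounding down in this halving is what pairing the windows gains
  d₁+d₂+a<c : d₁ + d₂ + a < c
  d₁+d₂+a<c = m+m<n+n⇒m<n (≤-pred (≤-pred (begin
    3 + ((d₁ + d₂ + a) + (d₁ + d₂ + a))       ≡⟨ add-windows a d₁ d₂ ⟩
    (2 + a + (d₁ + d₁)) + (1 + a + (d₂ + d₂)) ≤⟨ +-mono-≤ window₁ window₂ ⟩
    suc c + suc c                             ≡⟨ +-suc (suc c) c ⟩
    2 + (c + c)                               ∎)))

capacity-gap : ∀ {a k c} → 1 ≤ a → a ≤ k → a < c →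
  k * (2 * a * c + 1) + a * (k * k) ≤ 2 * (k * k) * c + a + k * (a * a)
capacity-gap {suc a} _ a≤k a<c
  with r , refl ← m≤n⇒∃[o]m+o≡n a≤k
  with q , refl ← m≤n⇒∃[o]m+o≡n a<c =
  ≤-trans (m≤m+n _ _) (≤-reflexive (identity a r q))
  where
  -- the slack is (k − a)((2c − a)k − 1), with k = suc a + r and c = suc (suc a) + q
  identity : ∀ a r q → let k = suc a + r ; c = suc (suc a) + q in
    k * (2 * suc a * c + 1) + suc a * (k * k) + r * ((2 + a + 2 * q) * k + a + r)
      ≡ 2 * (k * k) * c + suc a + k * (suc a * suc a)
  identity = solve-∀

scale-to-capacity : ∀ {a k c S} → 1 ≤ a → a ≤ k → a < c →
  4 * S + a * a ≤ 2 * a * c + 1 →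
  4 * k * S + a * (k * k) ≤ 2 * (k * k) * c + a
scale-to-capacity {a} {k} {c} {S} 1≤a a≤k a<c bound =
  +-cancelʳ-≤ (k * (a * a)) _ _ (begin
    4 * k * S + a * (k * k) + k * (a * a) ≡⟨ regroup a k S ⟩
    k * (4 * S + a * a) + a * (k * k)     ≤⟨ +-monoˡ-≤ (a * (k * k)) (*-monoʳ-≤ k bound) ⟩
    k * (2 * a * c + 1) + a * (k * k)     ≤⟨ capacity-gap 1≤a a≤k a<c ⟩
    2 * (k * k) * c + a + k * (a * a)     ∎)
  where
  open ≤-Reasoning
  regroup : ∀ a k S → 4 * k * S + a * (k * k) + k * (a * a) ≡ k * (4 * S + a * a) + a * (k * k)
  regroup = solve-∀

Unique-resp-↭ : ∀ {A : Set} {xs ys : List A} → xs ↭ ys → Unique xs → Unique ys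
Unique-resp-↭ {A} π = ↭ₛ.Unique-resp-↭ (setoid A) (↭⇒↭ₛ π)

below-top : ∀ {lo w zs} → All (λ y → lo ≤ y × y < lo + suc w) zs → All (lo + w ≢_) zs →
  All (λ y → lo ≤ y × y < lo + w) zs
below-top {lo} {w} inRange top∉ = All.zipWith narrow (inRange , top∉)
  where
  narrow : ∀ {y} → (lo ≤ y × y < lo + suc w) × lo + w ≢ y → lo ≤ y × y < lo + w
  narrow {y} ((lo≤y , y<lo+1+w) , top≢y) =
    lo≤y , ≤∧≢⇒< (≤-pred (subst (y <_) (+-suc lo w) y<lo+1+w)) (top≢y ∘ sym)

unique-in-range⇒length≤ : ∀ w {lo ys} → Unique ys →
  All (λ y → lo ≤ y × y < lo + w) ys → length ys ≤ w
unique-in-range⇒length≤ zero     []       []                  = z≤n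
unique-in-range⇒length≤ zero {lo} (_ ∷ _) ((lo≤y , y<lo+0) ∷ _) =
  contradiction (subst (_ <_) (+-identityʳ lo) y<lo+0) (≤⇒≯ lo≤y)
unique-in-range⇒length≤ (suc w) {lo} {ys} uniq inRange with lo + w ∈? ys
... | no top∉ys =
  m≤n⇒m≤1+n (unique-in-range⇒length≤ w uniq (below-top inRange (¬Any⇒All¬ ys top∉ys)))
... | yes top∈ys with us , vs , refl ← ∈-∃++ top∈ys
  with top∉rest ∷ uniq-rest ← Unique-resp-↭ (shift (lo + w) us vs) uniq
     | _ ∷ inRange-rest ← All-resp-↭ (shift (lo + w) us vs) inRange =
  subst (_≤ suc w) (sym (↭-length (shift (lo + w) us vs)))
    (s≤s (unique-in-range⇒length≤ w uniq-rest (below-top inRange-rest top∉rest)))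

unique-in-window⇒length≤ : ∀ {t c zs} → t + t ≤ c → Unique zs →
  All (λ z → t ≤ z × z + t ≤ c) zs → length zs + (t + t) ≤ suc c
unique-in-window⇒length≤ {t} {zs = zs} t+t≤c uniq inWindow
  with e , refl ← m≤n⇒∃[o]m+o≡n t+t≤c = begin
    length zs + (t + t) ≤⟨ +-monoˡ-≤ (t + t) |zs|≤1+e ⟩
    suc e + (t + t)     ≡⟨ cong suc (+-comm e (t + t)) ⟩
    suc (t + t + e)     ∎
  where
  open ≤-Reasoning
  in-range : ∀ {z} → t ≤ z × z + t ≤ t + t + e → t ≤ z × z < t + suc e
  in-range {z} (t≤z , z+t≤c) = t≤z , (begin-strict
    z           <⟨ s≤s (+-cancelʳ-≤ t z (t + e) (≤-trans z+t≤c (≤-reflexive (swap t e)))) ⟩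
    suc (t + e) ≡⟨ +-suc t e ⟨
    t + suc e   ∎)
    where
    swap : ∀ t e → t + t + e ≡ t + e + t
    swap = solve-∀
  |zs|≤1+e : length zs ≤ suc e
  |zs|≤1+e = unique-in-range⇒length≤ (suc e) uniq (All.map in-range inWindow)

-- A terminal at distance d from the depot, visited after p of the c steps of a tour.
Admissible : ℕ → ℕ → ℕ → Set
Admissible d p c = 1 ≤ d × d ≤ p × d + p ≤ c

module _ {X : Set} (d : X → ℕ) where

  extract-min : ∀ x xs → ∃₂ λ m rest → x ∷ xs ↭ m ∷ rest × All (λ y → d m ≤ d y) rest
  extract-min x [] = x , [] , ↭-refl , []
  extract-min x (y ∷ xs) with extract-min x xs
  ... | m , rest , π , m≤rest with d m ≤? d y
  ...   | yes m≤y = m , y ∷ rest ,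
    ↭-trans (↭-swap x y ↭-refl) (↭-trans (↭-prep y π) (↭-swap y m ↭-refl)) , m≤y ∷ m≤rest
  ...   | no  m≰y = y , m ∷ rest ,
    ↭-trans (↭-swap x y ↭-refl) (↭-prep y π) , y≤m ∷ All.map (≤-trans y≤m) m≤rest
    where y≤m = <⇒≤ (≰⇒> m≰y)

  extract-two-min : ∀ x y xs → ∃[ m₁ ] ∃[ m₂ ] ∃[ rest ]
    x ∷ y ∷ xs ↭ m₁ ∷ m₂ ∷ rest × All (λ z → d m₁ ≤ d z) (m₂ ∷ rest) × All (λ z → d m₂ ≤ d z) rest
  extract-two-min x y xs with extract-min x (y ∷ xs)
  ... | m₁ , []     , π₁ , _    = contradiction (↭-length π₁) λ ()
  ... | m₁ , z ∷ zs , π₁ , m₁≤ with extract-min z zs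
  ...   | m₂ , rest , π₂ , m₂≤ =
    m₁ , m₂ , rest , ↭-trans π₁ (↭-prep m₁ π₂) , All-resp-↭ π₂ m₁≤ , m₂≤

module _ {X : Set} (d p : X → ℕ) (c : ℕ) where

  AllAdmissible : List X → Set
  AllAdmissible = All (λ x → Admissible (d x) (p x) c)

  positions-in-window : ∀ t {x xs} → All (λ y → t ≤ d y) (x ∷ xs) →
    AllAdmissible (x ∷ xs) → Unique (map p (x ∷ xs)) → length (x ∷ xs) + (t + t) ≤ suc c
  positions-in-window t {x} {xs} far@(t≤dx ∷ _) adm@((_ , dx≤px , dx+px≤c) ∷ _) uniq =
    subst (λ ℓ → ℓ + (t + t) ≤ suc c) (length-map p (x ∷ xs))
      (unique-in-window⇒length≤ (≤-trans (+-mono-≤ t≤dx (≤-trans t≤dx dx≤px)) dx+px≤c) uniq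
        (window far adm))
    where
    window : ∀ {ys} → All (λ y → t ≤ d y) ys → AllAdmissible ys →
      All (λ z → t ≤ z × z + t ≤ c) (map p ys)
    window [] [] = []
    window {y ∷ _} (t≤dy ∷ far) ((_ , dy≤py , dy+py≤c) ∷ adm) =
      (≤-trans t≤dy dy≤py ,
       ≤-trans (+-monoʳ-≤ (p y) t≤dy) (subst (_≤ c) (+-comm (d y) (p y)) dy+py≤c))
        ∷ window far adm

  tour-bound-sized : ∀ a xs → length xs ≡ a → Unique (map p xs) → AllAdmissible xs →
    4 * sum (map d xs) + a * a ≤ 2 * a * c + 1
  tour-bound-sized zero          []           _ _ _ = z≤n
  tour-bound-sized (suc zero)    (x ∷ [])     _ _ ((_ , dx≤px , dx+px≤c) ∷ []) = begin
    4 * (d x + 0) + 1 * 1 ≡⟨ expand (d x) ⟩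
    2 * (d x + d x) + 1   ≤⟨ +-monoˡ-≤ 1 (*-monoʳ-≤ 2 (≤-trans (+-monoʳ-≤ (d x) dx≤px) dx+px≤c)) ⟩
    2 * c + 1             ∎
    where
    open ≤-Reasoning
    expand : ∀ e → 4 * (e + 0) + 1 * 1 ≡ 2 * (e + e) + 1
    expand = solve-∀
  tour-bound-sized (suc (suc a)) (x ∷ y ∷ xs) |xs|≡a uniq adm
    with m₁ , m₂ , rest , π , m₁≤ , m₂≤ ← extract-two-min d x y xs =
    subst (λ s → 4 * s + (2 + a) * (2 + a) ≤ 2 * (2 + a) * c + 1) (sym (sum-↭ (↭-map⁺ d π)))
      (pair-step {d₁ = d m₁} {d₂ = d m₂} {S = sum (map d rest)} window₁ window₂
        (tour-bound-sized a rest |rest|≡a (AllPairs.tail (AllPairs.tail uniq′))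
          (All.tail (All.tail adm′))))
    where
    |rest|≡a : length rest ≡ a
    |rest|≡a = suc-injective (suc-injective (trans (sym (↭-length π)) |xs|≡a))
    uniq′ : Unique (map p (m₁ ∷ m₂ ∷ rest))
    uniq′ = Unique-resp-↭ (↭-map⁺ p π) uniq
    adm′ : AllAdmissible (m₁ ∷ m₂ ∷ rest)
    adm′ = All-resp-↭ π adm
    window₁ : 2 + a + (d m₁ + d m₁) ≤ suc c
    window₁ = subst (λ ℓ → 2 + ℓ + (d m₁ + d m₁) ≤ suc c) |rest|≡a
      (positions-in-window (d m₁) (≤-refl ∷ m₁≤) adm′ uniq′)
    window₂ : 1 + a + (d m₂ + d m₂) ≤ suc c
    window₂ = subst (λ ℓ → 1 + ℓ + (d m₂ + d m₂) ≤ suc c) |rest|≡a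
      (positions-in-window (d m₂) (≤-refl ∷ m₂≤) (All.tail adm′) (AllPairs.tail uniq′))

  tour-bound : ∀ {k} xs → length xs ≤ k → Unique (map p xs) → AllAdmissible xs →
    4 * k * sum (map d xs) + length xs * (k * k) ≤ 2 * (k * k) * c + length xs
  tour-bound {k} [] _ _ _ rewrite *-zeroʳ (4 * k) = z≤n
  tour-bound {k} xs@(_ ∷ _) |xs|≤k uniq adm =
    scale-to-capacity (s≤s z≤n) |xs|≤k |xs|<c (tour-bound-sized (length xs) xs refl uniq adm)
    where
    |xs|<c : length xs < c
    |xs|<c = ≤-pred (subst (_≤ suc c) (+-comm (length xs) 2)
      (positions-in-window 1 (All.map proj₁ adm) adm uniq))

module _ {A : Set} where

  sum-map-+ : ∀ (f g : A → ℕ) xs → sum (map (λ x → f x + g x) xs) ≡ sum (map f xs) + sum (map g xs)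
  sum-map-+ f g []       = refl
  sum-map-+ f g (x ∷ xs) = trans (cong (f x + g x +_) (sum-map-+ f g xs)) (interchange (f x) (g x) _ _)
    where
    interchange : ∀ a b c d → a + b + (c + d) ≡ a + c + (b + d)
    interchange = solve-∀

  sum-map-*ˡ : ∀ c (f : A → ℕ) xs → sum (map (λ x → c * f x) xs) ≡ c * sum (map f xs)
  sum-map-*ˡ c f []       = sym (*-zeroʳ c)
  sum-map-*ˡ c f (x ∷ xs) = trans (cong (c * f x +_) (sum-map-*ˡ c f xs)) (sym (*-distribˡ-+ c (f x) _))

  sum-map-*ʳ : ∀ c (f : A → ℕ) xs → sum (map (λ x → f x * c) xs) ≡ sum (map f xs) * c
  sum-map-*ʳ c f []       = refl
  sum-map-*ʳ c f (x ∷ xs) = trans (cong (f x * c +_) (sum-map-*ʳ c f xs)) (sym (*-distribʳ-+ c (f x) _))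

  sum-map-mono-≤ : ∀ {f g : A → ℕ} → (∀ x → f x ≤ g x) → ∀ xs → sum (map f xs) ≤ sum (map g xs)
  sum-map-mono-≤ f≤g []       = z≤n
  sum-map-mono-≤ f≤g (x ∷ xs) = +-mono-≤ (f≤g x) (sum-map-mono-≤ f≤g xs)

  sum-map-0 : ∀ (xs : List A) → sum (map (λ _ → 0) xs) ≡ 0
  sum-map-0 []       = refl
  sum-map-0 (_ ∷ xs) = sum-map-0 xs

  length≡sum-map-1 : ∀ (xs : List A) → length xs ≡ sum (map (λ _ → 1) xs)
  length≡sum-map-1 []       = refl
  length≡sum-map-1 (x ∷ xs) = cong suc (length≡sum-map-1 xs)

sum-allFin-suc : ∀ {t} (h : Fin (suc t) → ℕ) →
  sum (map h (allFin (suc t))) ≡ h Fin.zero + sum (map (h ∘ Fin.suc) (allFin t))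
sum-allFin-suc {t} h = cong (λ hs → h Fin.zero + sum hs)
  (trans (map-tabulate Fin.suc h) (sym (map-tabulate (λ j → j) (h ∘ Fin.suc))))

indicator : ∀ {t} → Fin t → ℕ → Fin t → ℕ
indicator i v j = if does (i ≟ j) then v else 0

sum-indicator : ∀ {t} (i : Fin t) v → sum (map (indicator i v) (allFin t)) ≡ v
sum-indicator {suc t} Fin.zero v = begin
  sum (map (indicator Fin.zero v) (allFin (suc t))) ≡⟨ sum-allFin-suc {t} (indicator Fin.zero v) ⟩
  v + sum (map (λ _ → 0) (allFin t))                ≡⟨ cong (v +_) (sum-map-0 (allFin t)) ⟩
  v + 0                                             ≡⟨ +-identityʳ v ⟩
  v                                                 ∎
  where open ≡-Reasoning
sum-indicator {suc t} (Fin.suc i) v =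
  trans (sum-allFin-suc {t} (indicator (Fin.suc i) v)) (sum-indicator i v)

module _ {A : Set} {t} (a : A → Fin t) where

  block : Fin t → List A → List A
  block j = filter (λ x → a x ≟ j)

  sum-block-∷ : ∀ (f : A → ℕ) j x xs →
    sum (map f (block j (x ∷ xs))) ≡ indicator (a x) (f x) j + sum (map f (block j xs))
  sum-block-∷ f j x xs with does (a x ≟ j)
  ... | true  = refl
  ... | false = refl

  sum-blocks : ∀ (f : A → ℕ) xs → sum (map (λ j → sum (map f (block j xs))) (allFin t)) ≡ sum (map f xs)
  sum-blocks f []       = sum-map-0 (allFin t)
  sum-blocks f (x ∷ xs) = begin
    sum (map (λ j → sum (map f (block j (x ∷ xs)))) (allFin t))
      ≡⟨ cong sum (map-cong (λ j → sum-block-∷ f j x xs) (allFin t)) ⟩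
    sum (map (λ j → indicator (a x) (f x) j + sum (map f (block j xs))) (allFin t))
      ≡⟨ sum-map-+ (indicator (a x) (f x)) (λ j → sum (map f (block j xs))) (allFin t) ⟩
    sum (map (indicator (a x) (f x)) (allFin t)) + sum (map (λ j → sum (map f (block j xs))) (allFin t))
      ≡⟨ cong₂ _+_ (sum-indicator (a x) (f x)) (sum-blocks f xs) ⟩
    f x + sum (map f xs)
      ∎
    where open ≡-Reasoning

  length-blocks : ∀ xs → sum (map (λ j → length (block j xs)) (allFin t)) ≡ length xs
  length-blocks xs = begin
    sum (map (λ j → length (block j xs)) (allFin t))
      ≡⟨ cong sum (map-cong (λ j → length≡sum-map-1 (block j xs)) (allFin t)) ⟩
    sum (map (λ j → sum (map (λ _ → 1) (block j xs))) (allFin t))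
      ≡⟨ sum-blocks (λ _ → 1) xs ⟩
    sum (map (λ _ → 1) xs)
      ≡⟨ length≡sum-map-1 xs ⟨
    length xs
      ∎
    where open ≡-Reasoning

  blockwise-bound : ∀ α β γ (f : A → ℕ) (g : Fin t → ℕ) xs →
    (∀ j → α * sum (map f (block j xs)) + length (block j xs) * β ≤ γ * g j + length (block j xs)) →
    α * sum (map f xs) + length xs * β ≤ γ * sum (map g (allFin t)) + length xs
  blockwise-bound α β γ f g xs bound = begin
    α * sum (map f xs) + length xs * β
      ≡⟨ cong₂ (λ s ℓ → α * s + ℓ * β) (sum-blocks f xs) (length-blocks xs) ⟨
    α * sum (map F (allFin t)) + sum (map L (allFin t)) * β
      ≡⟨ cong₂ _+_ (sum-map-*ˡ α F (allFin t)) (sum-map-*ʳ β L (allFin t)) ⟨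
    sum (map (λ j → α * F j) (allFin t)) + sum (map (λ j → L j * β) (allFin t))
      ≡⟨ sum-map-+ (λ j → α * F j) (λ j → L j * β) (allFin t) ⟨
    sum (map (λ j → α * F j + L j * β) (allFin t))
      ≤⟨ sum-map-mono-≤ bound (allFin t) ⟩
    sum (map (λ j → γ * g j + L j) (allFin t))
      ≡⟨ sum-map-+ (λ j → γ * g j) L (allFin t) ⟩
    sum (map (λ j → γ * g j) (allFin t)) + sum (map L (allFin t))
      ≡⟨ cong₂ _+_ (sum-map-*ˡ γ g (allFin t)) (length-blocks xs) ⟩
    γ * sum (map g (allFin t)) + length xs
      ∎
    where
    open ≤-Reasoning
    F L : Fin t → ℕ
    F j = sum (map f (block j xs))
    L j = length (block j xs)

module _ {n} {G : Graph n} where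

  vertexAt : ∀ {u v m} → Walk G u v m → ℕ → Vertex n
  vertexAt {u} _          zero    = u
  vertexAt {u} here       (suc _) = u
  vertexAt     (step _ w) (suc i) = vertexAt w i

  snoc : ∀ {u v w m} → Walk G u v m → Graph.Adj G v w → Walk G u w (suc m)
  snoc here       e = step e here
  snoc (step e′ w) e = step e′ (snoc w e)

  reverse : ∀ {u v m} → Walk G u v m → Walk G v u m
  reverse here       = here
  reverse (step e w) = snoc (reverse w) (Graph.sym G e)

  record SplitAt {u v m} (w : Walk G u v m) (x : Vertex n) : Set where
    field
      position       : ℕ
      vertexAt-split : vertexAt w position ≡ x
      prefix         : Walk G u x position
      suffixLength   : ℕ
      suffix         : Walk G x v suffixLength
      lengths        : position + suffixLength ≡ m

  split-at-visit : ∀ {x u v m} {w : Walk G u v m} → Visits x w → SplitAt w x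
  split-at-visit vis-here        = record { position = 0 ; vertexAt-split = refl ; prefix = here
                                          ; suffixLength = 0 ; suffix = here ; lengths = refl }
  split-at-visit (vis-start e w) = record { position = 0 ; vertexAt-split = refl ; prefix = here
                                          ; suffixLength = _ ; suffix = step e w ; lengths = refl }
  split-at-visit (vis-later e w visits) = record
    { position = suc position ; vertexAt-split = vertexAt-split ; prefix = step e prefix
    ; suffixLength = suffixLength ; suffix = suffix ; lengths = cong suc lengths }
    where open SplitAt (split-at-visit visits)

  terminal-walk-nonempty : ∀ {i d} → Walk G (terminal i) depot d → 1 ≤ d
  terminal-walk-nonempty (step _ _) = s≤s z≤n

  visited-terminal-admissible : ∀ {i d m} {w : Walk G depot depot m} → IsDist G (terminal i) d →
    (s : SplitAt w (terminal i)) → Admissible d (SplitAt.position s) m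
  visited-terminal-admissible (shortest , minimal) s =
    terminal-walk-nonempty shortest ,
    minimal (reverse prefix) ,
    ≤-trans (+-monoˡ-≤ position (minimal suffix))
      (≤-reflexive (trans (+-comm suffixLength position) lengths))
    where open SplitAt s

Unique-map⁺-within : ∀ {A B : Set} {P : A → Set} {f : A → B} →
  (∀ {x y} → P x → P y → f x ≡ f y → x ≡ y) → ∀ {xs} → All P xs → Unique xs → Unique (map f xs)
Unique-map⁺-within inj []         []            = []
Unique-map⁺-within inj (px ∷ pxs) (x∉xs ∷ uniq) =
  All-map⁺ (All.zipWith (λ (py , x≢y) → x≢y ∘ inj px py) (pxs , x∉xs))
    ∷ Unique-map⁺-within inj pxs uniq

module _ {n} {G : Graph n} {k} (S : Solution G k) where

  open Solution S

  members : Fin t → List (Fin n)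
  members j = block assign j (allFin n)

  split : ∀ i → SplitAt (proj₂ (tours (assign i))) (terminal i)
  split i = split-at-visit (covers i)

  position : Fin n → ℕ
  position i = SplitAt.position (split i)

  same-tour-same-position : ∀ {j i i′} → assign i ≡ j → assign i′ ≡ j →
    position i ≡ position i′ → i ≡ i′
  same-tour-same-position {i = i} {i′} i∈j i′∈j eq = Fin.suc-injective (begin
    terminal i                                         ≡⟨ SplitAt.vertexAt-split (split i) ⟨
    vertexAt (proj₂ (tours (assign i))) (position i)   ≡⟨ cong₂ (vertexAt ∘ proj₂ ∘ tours) (trans i∈j (sym i′∈j)) eq ⟩
    vertexAt (proj₂ (tours (assign i′))) (position i′) ≡⟨ SplitAt.vertexAt-split (split i′) ⟩
    terminal i′                                        ∎)
    where open ≡-Reasoning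

  solution-tour-bound : ∀ {dist : Fin n → ℕ} → (∀ i → IsDist G (terminal i) (dist i)) → ∀ j →
    4 * k * sum (map dist (members j)) + length (members j) * (k * k)
      ≤ 2 * (k * k) * cost (tours j) + length (members j)
  solution-tour-bound {dist} isDist j =
    tour-bound dist position (cost (tours j)) (members j) (capacity j)
      (Unique-map⁺-within same-tour-same-position in-tour
        (Unique.filter⁺ (λ i → assign i ≟ j) (Unique.allFin⁺ n)))
      (All.map (λ { refl → visited-terminal-admissible (isDist _) (split _) }) in-tour)
    where
    in-tour : All (λ i → assign i ≡ j) (members j)
    in-tour = all-filter (λ i → assign i ≟ j) (allFin n)

theorem1p1 : (n : ℕ) (G : Graph n) → Connected G → (k : ℕ) → 1 ≤ k → k ≤ n →
    (dist : Fin n → ℕ) → (∀ i → IsDist G (terminal i) (dist i)) →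
    (S : Solution G k) →
    4 * k * sum (map dist (allFin n)) + n * (k * k) ≤ 2 * (k * k) * Solution.totalCost S + n
theorem1p1 n G _ k _ _ dist isDist S =
  subst (λ ℓ → 4 * k * sum (map dist (allFin n)) + ℓ * (k * k) ≤ 2 * (k * k) * totalCost + ℓ)
    (length-tabulate (λ i → i))
    (blockwise-bound assign (4 * k) (k * k) (2 * (k * k)) dist (cost ∘ tours) (allFin n)
      (solution-tour-bound S isDist))
  where open Solution S
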